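{- If $G$ is any graph then the family $\{\overline{K}_n \vee G\}_{n=1}^\infty$ of $n$-cones is sensitive.
   Context: All graphs are finite, undirected and simple. $\overline{K}_n$ denotes the empty (edgeless) graph on $n$ vertices and $\overline{K}_n\vee G$ (the join: disjoint union plus all edges between $\overline{K}_n$ and $G$) is called the $n$-cone of $G$. $\alpha(G)$ is the independence number and $\Delta(G)$ the maximum degree. The sensitivity of a nonempty graph $G=(V,E)$ is $\sigma(G)=\min\{\Delta(G[S]) : S\subseteq V,\ |S|>\alpha(G)\}$. An indexed family of graphs $G_n$ with $\Delta(G_n)\to\infty$ is sensitive if $\sigma(G_n)\to\infty$ and insensitive otherwise. -}

module Defs where

open import Data.Bool using (Bool; true; false; _∧_; not; if_then_else_)
open import Data.Nat using (ℕ; zero; suc; _+_; _⊔_; _⊓_; _<ᵇ_)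
open import Data.Fin using (Fin; splitAt)
open import Data.Fin.Subset using (Subset; ∣_∣)
open import Data.Sum using (inj₁; inj₂)
open import Data.Vec using (Vec; []; _∷_; lookup)
open import Data.List using (List; []; _∷_; map; _++_; filter; foldr; allFin)
open import Data.Bool using (T)
open import Relation.Nullary.Decidable using (Dec)
open import Data.Bool.Properties using (T?)
open import Relation.Binary.PropositionalEquality using (_≡_; refl)

record Graph (n : ℕ) : Set where
  field
    adj    : Fin n → Fin n → Bool
    sym    : ∀ u v → adj u v ≡ adj v u
    irrefl : ∀ v → adj v v ≡ false
open Graph public

-- The n-cone  K̄_n ∨ G  on vertex set Fin (n + m):
-- the first n vertices form the edgeless part, the last m are a copy of G.
coneAdj : (n : ℕ) {m : ℕ} → Graph m → Fin (n + m) → Fin (n + m) → Bool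
coneAdj n G u v with splitAt n u | splitAt n v
... | inj₁ _ | inj₁ _ = false
... | inj₁ _ | inj₂ _ = true
... | inj₂ _ | inj₁ _ = true
... | inj₂ a | inj₂ b = adj G a b

coneSym : (n : ℕ) {m : ℕ} (G : Graph m) → ∀ u v → coneAdj n G u v ≡ coneAdj n G v u
coneSym n G u v with splitAt n u | splitAt n v
... | inj₁ _ | inj₁ _ = refl
... | inj₁ _ | inj₂ _ = refl
... | inj₂ _ | inj₁ _ = refl
... | inj₂ a | inj₂ b = sym G a b

coneIrrefl : (n : ℕ) {m : ℕ} (G : Graph m) → ∀ v → coneAdj n G v v ≡ false
coneIrrefl n G v with splitAt n v
... | inj₁ _ = refl
... | inj₂ a = irrefl G a

cone : (n : ℕ) {m : ℕ} → Graph m → Graph (n + m)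
cone n G = record { adj = coneAdj n G ; sym = coneSym n G ; irrefl = coneIrrefl n G }

allSubsets : (k : ℕ) → List (Subset k)
allSubsets zero    = [] ∷ []
allSubsets (suc k) = map (true ∷_) (allSubsets k) ++ map (false ∷_) (allSubsets k)

maxList : List ℕ → ℕ
maxList = foldr _⊔_ 0

-- minimum of a list (0 for the empty list; never used on an empty list
-- for the graphs considered here, since V itself always qualifies when G
-- has an edge)
minList : List ℕ → ℕ
minList []       = 0
minList (x ∷ xs) = foldr _⊓_ x xs

module _ {k : ℕ} (H : Graph k) where

  degIn : Subset k → Fin k → ℕ
  degIn S v = foldr (λ u r → (if lookup S u ∧ adj H v u then 1 else 0) + r) 0 (allFin k)

  ΔInduced : Subset k → ℕ
  ΔInduced S = maxList (map (λ v → if lookup S v then degIn S v else 0) (allFin k))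

  maxDegree : ℕ
  maxDegree = maxList (map (λ v → degIn (Data.Vec.replicate k true) v) (allFin k))

  independent : Subset k → Bool
  independent S = foldr _∧_ true
    (map (λ u → foldr _∧_ true
      (map (λ v → not (lookup S u ∧ lookup S v ∧ adj H u v)) (allFin k))) (allFin k))

  α : ℕ
  α = maxList (map ∣_∣ (filter (λ S → T? (independent S)) (allSubsets k)))

  σ : ℕ
  σ = minList (map ΔInduced (filter (λ S → T? (α <ᵇ ∣ S ∣)) (allSubsets k)))

-- Every vertex of G is adjacent to all n vertices of K̄ₙ, so Δ(K̄ₙ ∨ G) ≥ n. Since K̄ₙ is
-- independent, α ≥ n; hence a set S with |S| > α has more than n vertices, so it contains
-- a vertex w of G, and w is adjacent to all vertices of S in K̄ₙ, of which there are at
-- least |S| − m, where m = |V(G)|. Thus σ(K̄ₙ ∨ G) ≥ n − m, which grows without bound.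
module Submission where

open import Defs hiding (sym)
open import Data.Nat using (ℕ; zero; suc; _+_; _∸_; _≤_; _<_; _⊓_; _<ᵇ_; z≤n; s≤s)
open import Data.Nat.Properties
open import Data.Product using (∃; _×_; _,_; proj₁; proj₂)
open import Data.Sum using (inj₁; inj₂)
open import Data.Empty using (⊥-elim)
open import Data.Unit using (tt)
open import Data.Bool using (Bool; true; false; _∧_; not; if_then_else_; T)
open import Data.Bool.Properties using (T?; T-∧)
open import Data.Fin as Fin using (Fin; splitAt; _↑ˡ_; _↑ʳ_)
open import Data.Fin.Properties using (splitAt-↑ˡ; splitAt-↑ʳ; toℕ<n)
open import Data.Fin.Subset using (Subset; ∣_∣; ⊤; ⊥)
open import Data.Fin.Subset.Properties using (∣⊤∣≡n; ∣⊥∣≡0)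
open import Data.Vec using ([]; _∷_; _++_; lookup; replicate)
open import Data.Vec.Properties using (lookup-replicate; lookup-splitAt)
open import Data.List using (map; filter; foldr; allFin)
import Data.List as List
open import Data.List.Membership.Propositional using (_∈_)
open import Data.List.Membership.Propositional.Properties
  using (∈-map⁺; ∈-map⁻; ∈-++⁺ˡ; ∈-++⁺ʳ; ∈-filter⁺; ∈-filter⁻; ∈-allFin)
open import Data.List.Relation.Unary.Any using (here; there)
import Data.List.Relation.Unary.All as All
open import Data.List.Relation.Unary.All.Properties using (all⁺; all⁻)
open import Function using (_∘_; _⇔_; mk⇔; Equivalence)
open import Relation.Nullary using (¬_; yes; no)
open import Relation.Binary.PropositionalEquality
  using (_≡_; refl; sym; trans; cong; cong₂; subst)

count : (k : ℕ) → (Fin k → Bool) → ℕ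
count zero    f = 0
count (suc k) f = (if f Fin.zero then 1 else 0) + count k (f ∘ Fin.suc)

count-mono : ∀ k {f g : Fin k → Bool} → (∀ i → T (f i) → T (g i)) → count k f ≤ count k g
count-mono zero    f⇒g = z≤n
count-mono (suc k) {f} {g} f⇒g = +-mono-≤ (head (f Fin.zero) (g Fin.zero) (f⇒g Fin.zero))
                                          (count-mono k (f⇒g ∘ Fin.suc))
  where
  head : ∀ a b → (T a → T b) → (if a then 1 else 0) ≤ (if b then 1 else 0)
  head false b     _   = z≤n
  head true  true  _   = ≤-refl
  head true  false a⇒b = ⊥-elim (a⇒b tt)

count≤ : ∀ k (f : Fin k → Bool) → count k f ≤ k
count≤ zero    f = z≤n
count≤ (suc k) f with f Fin.zero
... | true  = s≤s (count≤ k (f ∘ Fin.suc))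
... | false = m≤n⇒m≤1+n (count≤ k (f ∘ Fin.suc))

count< : ∀ k (f : Fin k → Bool) i → ¬ T (f i) → count k f < k
count< (suc k) f Fin.zero ¬fi with f Fin.zero
... | true  = ⊥-elim (¬fi tt)
... | false = s≤s (count≤ k (f ∘ Fin.suc))
count< (suc k) f (Fin.suc i) ¬fi with f Fin.zero
... | true  = s≤s (count< k (f ∘ Fin.suc) i ¬fi)
... | false = m<n⇒m<1+n (count< k (f ∘ Fin.suc) i ¬fi)

count-witness : ∀ k (f : Fin k → Bool) → 0 < count k f → ∃ λ i → T (f i)
count-witness (suc k) f pos with f Fin.zero in f0
... | true  = Fin.zero , subst T (sym f0) tt
... | false with count-witness k (f ∘ Fin.suc) pos
...   | i , fi = Fin.suc i , fi

count-all : ∀ k (f : Fin k → Bool) → (∀ i → T (f i)) → count k f ≡ k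
count-all zero    f all = refl
count-all (suc k) f all with f Fin.zero | all Fin.zero
... | true | _ = cong suc (count-all k (f ∘ Fin.suc) (all ∘ Fin.suc))

count-++ : ∀ n m (f : Fin (n + m) → Bool) →
           count (n + m) f ≡ count n (f ∘ (_↑ˡ m)) + count m (f ∘ (n ↑ʳ_))
count-++ zero    m f = refl
count-++ (suc n) m f =
  trans (cong (f₀ +_) (count-++ n m (f ∘ Fin.suc))) (sym (+-assoc f₀ _ _))
  where f₀ = if f Fin.zero then 1 else 0

∣∣≡count : ∀ {k} (S : Subset k) → ∣ S ∣ ≡ count k (lookup S)
∣∣≡count []          = refl
∣∣≡count (true ∷ S)  = cong suc (∣∣≡count S)
∣∣≡count (false ∷ S) = ∣∣≡count S

∣++∣ : ∀ {n m} (p : Subset n) (q : Subset m) → ∣ p ++ q ∣ ≡ ∣ p ∣ + ∣ q ∣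
∣++∣ []          q = refl
∣++∣ (true ∷ p)  q = cong suc (∣++∣ p q)
∣++∣ (false ∷ p) q = ∣++∣ p q

foldr-tabulate≡count : ∀ k {A : Set} (h : Fin k → A) (p : A → Bool) →
  foldr (λ u r → (if p u then 1 else 0) + r) 0 (List.tabulate h) ≡ count k (p ∘ h)
foldr-tabulate≡count zero    h p = refl
foldr-tabulate≡count (suc k) h p = cong (_ +_) (foldr-tabulate≡count k (h ∘ Fin.suc) p)

maxList-ub : ∀ {x xs} → x ∈ xs → x ≤ maxList xs
maxList-ub {xs = y List.∷ ys} (here refl) = m≤m⊔n y (maxList ys)
maxList-ub {xs = y List.∷ ys} (there x∈) = ≤-trans (maxList-ub x∈) (m≤n⊔m y (maxList ys))

maxList< : ∀ {c} xs → 0 < c → (∀ {x} → x ∈ xs → x < c) → maxList xs < c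
maxList< List.[]        0<c xs<c = 0<c
maxList< (x List.∷ xs) 0<c xs<c = ⊔-lub (xs<c (here refl)) (maxList< xs 0<c (xs<c ∘ there))

minList-lb : ∀ {b x xs} → x ∈ xs → (∀ {y} → y ∈ xs → b ≤ y) → b ≤ minList xs
minList-lb {xs = y List.∷ ys} _ b≤xs = foldr-glb ys (b≤xs (here refl)) (b≤xs ∘ there)
  where
  foldr-glb : ∀ {b a} ys → b ≤ a → (∀ {y} → y ∈ ys → b ≤ y) → b ≤ foldr _⊓_ a ys
  foldr-glb List.[]        b≤a b≤ys = b≤a
  foldr-glb (y List.∷ ys) b≤a b≤ys = ⊓-glb (b≤ys (here refl)) (foldr-glb ys b≤a (b≤ys ∘ there))

∈-allSubsets : ∀ {k} (S : Subset k) → S ∈ allSubsets k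
∈-allSubsets []          = here refl
∈-allSubsets (true ∷ S)  = ∈-++⁺ˡ (∈-map⁺ (true ∷_) (∈-allSubsets S))
∈-allSubsets (false ∷ S) = ∈-++⁺ʳ _ (∈-map⁺ (false ∷_) (∈-allSubsets S))

T-not⇔¬T : ∀ b → T (not b) ⇔ (¬ T b)
T-not⇔¬T true  = mk⇔ (λ ()) (λ ¬t → ¬t tt)
T-not⇔¬T false = mk⇔ (λ _ ()) (λ _ → tt)

module _ {k : ℕ} (H : Graph k) where

  degIn≡count : ∀ S v → degIn H S v ≡ count k (λ u → lookup S u ∧ adj H v u)
  degIn≡count S v = foldr-tabulate≡count k (λ u → u) (λ u → lookup S u ∧ adj H v u)

  degIn≤ΔInduced : ∀ {S v} → T (lookup S v) → degIn H S v ≤ ΔInduced H S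
  degIn≤ΔInduced {S} {v} v∈S =
    ≤-trans (≤-reflexive (sym (selected v∈S))) (maxList-ub (∈-map⁺ _ (∈-allFin v)))
    where
    selected : ∀ {b} → T b → (if b then degIn H S v else 0) ≡ degIn H S v
    selected {true} _ = refl

  degIn⊤≤maxDegree : ∀ v → degIn H ⊤ v ≤ maxDegree H
  degIn⊤≤maxDegree v = maxList-ub (∈-map⁺ _ (∈-allFin v))

  noEdge? : Subset k → Fin k → Fin k → Bool
  noEdge? S u v = not (lookup S u ∧ lookup S v ∧ adj H u v)

  noEdgeFrom? : Subset k → Fin k → Bool
  noEdgeFrom? S u = foldr _∧_ true (map (noEdge? S u) (allFin k))

  independent⁺ : ∀ {S} → (∀ u v → T (lookup S u) → T (lookup S v) → ¬ T (adj H u v)) →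
                 T (independent H S)
  independent⁺ {S} noEdge =
    all⁻ (noEdgeFrom? S) {xs = allFin k} (All.tabulate λ {u} _ →
      all⁻ (noEdge? S u) {xs = allFin k} (All.tabulate λ {v} _ →
        Equivalence.from (T-not⇔¬T (lookup S u ∧ lookup S v ∧ adj H u v)) λ uv∈S →
          let u∈S , v∈S∧e = Equivalence.to T-∧ uv∈S
              v∈S , e     = Equivalence.to (T-∧ {lookup S v}) v∈S∧e
          in noEdge u v u∈S v∈S e))

  independent⁻ : ∀ {S} → T (independent H S) →
                 ∀ {u v} → T (lookup S u) → T (lookup S v) → ¬ T (adj H u v)
  independent⁻ {S} ind {u} {v} u∈S v∈S e =
    Equivalence.to (T-not⇔¬T _) noEdge
      (Equivalence.from T-∧ (u∈S , Equivalence.from T-∧ (v∈S , e)))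
    where
    noEdge : T (noEdge? S u v)
    noEdge = All.lookup (all⁺ (noEdge? S u) (allFin k)
                          (All.lookup (all⁺ (noEdgeFrom? S) (allFin k) ind) (∈-allFin u)))
                        (∈-allFin v)

  independent⇒∣∣≤α : ∀ {S} → T (independent H S) → ∣ S ∣ ≤ α H
  independent⇒∣∣≤α {S} ind =
    maxList-ub (∈-map⁺ ∣_∣ (∈-filter⁺ (λ S → T? (independent H S)) (∈-allSubsets S) ind))

  independent⇒∣∣<order : ∀ {u v} → T (adj H u v) → ∀ {S} → T (independent H S) → ∣ S ∣ < k
  independent⇒∣∣<order {u} {v} e {S} ind with T? (lookup S u) | T? (lookup S v)
  ... | yes u∈S | yes v∈S = ⊥-elim (independent⁻ {S} ind u∈S v∈S e)
  ... | no u∉S  | _       = subst (_< k) (sym (∣∣≡count S)) (count< k (lookup S) u u∉S)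
  ... | yes _   | no v∉S  = subst (_< k) (sym (∣∣≡count S)) (count< k (lookup S) v v∉S)

  adj⇒α<order : ∀ {u v} → T (adj H u v) → α H < k
  adj⇒α<order {u} e = maxList< _ (≤-<-trans z≤n (toℕ<n u)) bounded
    where
    bounded : ∀ {x} → x ∈ map ∣_∣ (filter (λ S → T? (independent H S)) (allSubsets k)) → x < k
    bounded x∈ with ∈-map⁻ ∣_∣ x∈
    ... | S , S∈ , refl with ∈-filter⁻ (λ S → T? (independent H S)) {xs = allSubsets k} S∈
    ...   | _ , ind = independent⇒∣∣<order e {S} ind

  -- The hypothesis α H < k puts ⊤ among the candidates: on an empty family minList would be 0.
  σ-glb : ∀ {b} → α H < k → (∀ S → α H < ∣ S ∣ → b ≤ ΔInduced H S) → b ≤ σ H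
  σ-glb {b} α<k large⇒b≤Δ =
    minList-lb (∈-map⁺ (ΔInduced H) (∈-filter⁺ large? (∈-allSubsets ⊤) ⊤-large)) bounded
    where
    large? = λ S → T? (α H <ᵇ ∣ S ∣)
    ⊤-large : T (α H <ᵇ ∣ ⊤ {k} ∣)
    ⊤-large = <⇒<ᵇ (subst (α H <_) (sym (∣⊤∣≡n k)) α<k)
    bounded : ∀ {y} → y ∈ map (ΔInduced H) (filter large? (allSubsets k)) → b ≤ y
    bounded y∈ with ∈-map⁻ (ΔInduced H) y∈
    ... | S , S∈ , refl with ∈-filter⁻ large? {xs = allSubsets k} S∈
    ...   | _ , large = large⇒b≤Δ S (<ᵇ⇒< _ _ large)

module _ {m : ℕ} (G : Graph m) where

  coneAdj-↑ʳ-↑ˡ : ∀ n j i → T (coneAdj n G (n ↑ʳ j) (i ↑ˡ m))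
  coneAdj-↑ʳ-↑ˡ n j i rewrite splitAt-↑ʳ n m j | splitAt-↑ˡ n i m = tt

  K̄ : ∀ n → Subset (n + m)
  K̄ n = ⊤ {n} ++ ⊥ {m}

  ∣K̄∣≡n : ∀ n → ∣ K̄ n ∣ ≡ n
  ∣K̄∣≡n n = trans (∣++∣ (⊤ {n}) (⊥ {m})) (trans (cong₂ _+_ (∣⊤∣≡n n) (∣⊥∣≡0 m)) (+-identityʳ n))

  K̄-noEdge : ∀ n u v → T (lookup (K̄ n) u) → T (lookup (K̄ n) v) → ¬ T (coneAdj n G u v)
  K̄-noEdge n u v
    rewrite lookup-splitAt n (⊤ {n}) (⊥ {m}) u | lookup-splitAt n (⊤ {n}) (⊥ {m}) v
    with splitAt n u | splitAt n v
  ... | inj₁ _ | inj₁ _ = λ _ _ ()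
  ... | inj₁ _ | inj₂ j = λ _ v∈K̄ _ → subst T (lookup-replicate j false) v∈K̄
  ... | inj₂ i | _      = λ u∈K̄ _ _ → subst T (lookup-replicate i false) u∈K̄

  n≤α-cone : ∀ n → n ≤ α (cone n G)
  n≤α-cone n = subst (_≤ α (cone n G)) (∣K̄∣≡n n)
    (independent⇒∣∣≤α (cone n G) {K̄ n} (independent⁺ (cone n G) {K̄ n} (K̄-noEdge n)))

  count-↑ˡ≤degIn-↑ʳ : ∀ n S j → count n (lookup S ∘ (_↑ˡ m)) ≤ degIn (cone n G) S (n ↑ʳ j)
  count-↑ˡ≤degIn-↑ʳ n S j = begin
    count n (lookup S ∘ (_↑ˡ m))
      ≤⟨ count-mono n (λ i i∈S → Equivalence.from T-∧ (i∈S , coneAdj-↑ʳ-↑ˡ n j i)) ⟩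
    count n (neighbourInS ∘ (_↑ˡ m))
      ≤⟨ m≤m+n _ _ ⟩
    count n (neighbourInS ∘ (_↑ˡ m)) + count m (neighbourInS ∘ (n ↑ʳ_))
      ≡⟨ count-++ n m neighbourInS ⟨
    count (n + m) neighbourInS
      ≡⟨ degIn≡count (cone n G) S (n ↑ʳ j) ⟨
    degIn (cone n G) S (n ↑ʳ j)
      ∎
    where
    open ≤-Reasoning
    neighbourInS : Fin (n + m) → Bool
    neighbourInS u = lookup S u ∧ coneAdj n G (n ↑ʳ j) u

  n≤maxDegree-cone : ∀ n → Fin m → n ≤ maxDegree (cone n G)
  n≤maxDegree-cone n j = begin
    n                             ≡⟨ count-all n _ (λ i → subst T (sym (⊤-↑ˡ i)) tt) ⟨
    count n (lookup ⊤ ∘ (_↑ˡ m))  ≤⟨ count-↑ˡ≤degIn-↑ʳ n ⊤ j ⟩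
    degIn (cone n G) ⊤ (n ↑ʳ j)   ≤⟨ degIn⊤≤maxDegree (cone n G) (n ↑ʳ j) ⟩
    maxDegree (cone n G)          ∎
    where
    open ≤-Reasoning
    ⊤-↑ˡ : ∀ i → lookup ⊤ (i ↑ˡ m) ≡ true
    ⊤-↑ˡ i = lookup-replicate (i ↑ˡ m) true

  ∣∣∸m≤ΔInduced-cone : ∀ n S → n < ∣ S ∣ → ∣ S ∣ ∸ m ≤ ΔInduced (cone n G) S
  ∣∣∸m≤ΔInduced-cone n S n<∣S∣ = begin
    ∣ S ∣ ∸ m                        ≡⟨ cong (_∸ m) ∣S∣≡a+b ⟩
    (a + b) ∸ m                      ≤⟨ ∸-monoʳ-≤ (a + b) (count≤ m _) ⟩
    (a + b) ∸ b                      ≡⟨ m+n∸n≡m a b ⟩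
    a                                ≤⟨ count-↑ˡ≤degIn-↑ʳ n S j ⟩
    degIn (cone n G) S (n ↑ʳ j)      ≤⟨ degIn≤ΔInduced (cone n G) {S} w∈S ⟩
    ΔInduced (cone n G) S            ∎
    where
    open ≤-Reasoning
    a = count n (lookup S ∘ (_↑ˡ m))
    b = count m (lookup S ∘ (n ↑ʳ_))
    ∣S∣≡a+b : ∣ S ∣ ≡ a + b
    ∣S∣≡a+b = trans (∣∣≡count S) (count-++ n m (lookup S))
    0<b : 0 < b
    0<b = +-cancelˡ-< a 0 b (begin-strict
      a + 0     ≡⟨ +-identityʳ a ⟩
      a         ≤⟨ count≤ n _ ⟩
      n         <⟨ n<∣S∣ ⟩
      ∣ S ∣     ≡⟨ ∣S∣≡a+b ⟩
      a + b     ∎)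
    witness : ∃ λ j → T (lookup S (n ↑ʳ j))
    witness = count-witness m _ 0<b
    j = proj₁ witness
    w∈S = proj₂ witness

  n∸m≤σ-cone : ∀ n → Fin m → n ∸ m ≤ σ (cone n G)
  n∸m≤σ-cone zero    _ = ≤-trans (≤-reflexive (0∸n≡0 m)) z≤n
  n∸m≤σ-cone (suc n) j = σ-glb (cone (suc n) G) α<order λ S α<∣S∣ →
    let n<∣S∣ = ≤-<-trans (n≤α-cone (suc n)) α<∣S∣
    in ≤-trans (∸-monoˡ-≤ m (<⇒≤ n<∣S∣)) (∣∣∸m≤ΔInduced-cone (suc n) S n<∣S∣)
    where
    α<order : α (cone (suc n) G) < suc n + m
    α<order = adj⇒α<order (cone (suc n) G) {suc n ↑ʳ j} {Fin.zero ↑ˡ m}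
                (coneAdj-↑ʳ-↑ˡ (suc n) j Fin.zero)

corollary3p8 : ∀ {m : ℕ} (G : Graph (suc m)) → (∀ B → ∃ λ N → ∀ n → N ≤ n → B ≤ maxDegree (cone n G)) × (∀ B → ∃ λ N → ∀ n → N ≤ n → B ≤ σ (cone n G))
corollary3p8 {m} G =
  (λ B → B , λ n B≤n → ≤-trans B≤n (n≤maxDegree-cone G n Fin.zero)) ,
  (λ B → B + suc m , λ n B+m<n → ≤-trans (m+n≤o⇒m≤o∸n B B+m<n) (n∸m≤σ-cone G n Fin.zero))
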